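{- Let $N,k,r$ be positive integers with $r\ge k$, and let $N=\binom{N_k}{k}_{\!r}+\binom{N_{k-1}}{k-1}_{\!r-1}+\dots+\binom{N_{k-s}}{k-s}_{\!r-s}$ be the $(k,r)$-canonical representation of $N$. Define $N_+^{(k,r)} :=\sum_{i=0}^{s}\binom{N_{k-i}+r-i}{k-i}_{\!r-i}$ and $N_-^{(k,r)} :=\sum_{i=0}^{s}\binom{N_{k-i}-(r-i)}{k-i}_{\!r-i}$. Then: (i) the $(k,r)$-canonical representation of $N_+^{(k,r)}$ is $\sum_{i=0}^{s}\binom{N_{k-i}+r-i}{k-i}_{\!r-i}$; (ii) if $N_k-r\geq k$, then the $(k,r)$-canonical representation of $N_-^{(k,r)}$ is $\sum_{i=0}^{s_0}\binom{N_{k-i}-(r-i)}{k-i}_{\!r-i}$, where $s_0 := \max\{t: t\leq s,\ N_{k-t} - (r-t) \geq k-t\}$; if instead $N_k-r < k$, then $N_-^{(k,r)} = 0$; (iii) if $L$ is a positive integer with $(k,r)$-canonical representation $L = \sum_{i=0}^{t}\binom{L_{k-i}}{k-i}_{\!r-i}$, then $L<N$ if and only if either $t<s$ and $L_{k-i}=N_{k-i}$ for all $0\le i\le t$, or the minimal $i$ with $L_{k-i}\neq N_{k-i}$ satisfies $L_{k-i}<N_{k-i}$; (iv) for $L$ as in (iii) and any $0\leq m\leq t$, $\binom{L_{k-m}+1}{k-m}_{\!r-m} > \sum_{i=m}^{t}\binom{L_{k-i}}{k-i}_{\!r-i}$; (v) for $L$ as in (iii), with $L_+^{(k,r)}$ defined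 analogously from its canonical representation, $L_+^{(k,r)} \leq N$ if and only if $L \leq N_-^{(k,r)}$.
   Context: The Turán graph $T_d(n)$ is the complete $d$-partite graph on $n$ vertices with parts of sizes $\lfloor n/d\rfloor$ or $\lceil n/d\rceil$ (for $n\le d$ it is $K_n$). For integers $n,k$, $\binom{n}{k}_{\!d}$ is the number of $k$-cliques of $T_d(n)$ when $0\le k\le n$, and $\binom{n}{k}_{\!d}=0$ if $k>n$, $k<0$ or $n<0$. For positive integers $N,k,r$ with $r\ge k$ there are unique integers $s,N_k,N_{k-1},\dots,N_{k-s}$ such that $N=\sum_{i=0}^{s}\binom{N_{k-i}}{k-i}_{\!r-i}$, $N_{k-i}-\lfloor N_{k-i}/(r-i)\rfloor>N_{k-i-1}$ for all $0\le i<s$, and $N_{k-s}\ge k-s>0$; this is the $(k,r)$-canonical representation of $N$. -}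

module Defs where

open import Data.Nat using (ℕ; zero; suc; _+_; _*_; _∸_; _≤_; _<_)
open import Data.Nat.DivMod using (_/_; _%_)
open import Data.List using (List; []; _∷_; replicate; _++_; map; length; take)
open import Data.Integer as ℤ using (ℤ; +_; -[1+_])
open import Data.Product using (_×_)
open import Relation.Binary.PropositionalEquality using (_≡_)

-- Part sizes of the Turán graph T_d(n): d parts, (n mod d) of size
-- ⌊n/d⌋+1 and the remaining d - (n mod d) of size ⌊n/d⌋.
-- (d = 0 never occurs in the statement; it yields no parts.)
turanParts : ℕ → ℕ → List ℕ
turanParts zero    n = []
turanParts (suc d) n =
  replicate (n % suc d) (suc (n / suc d)) ++ replicate (suc d ∸ n % suc d) (n / suc d)

-- Number of k-cliques of a complete multipartite graph with the given part
-- sizes: a k-clique picks k distinct parts and one vertex in each, so this is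
-- the k-th elementary symmetric polynomial of the part sizes.
cliques : ℕ → List ℕ → ℕ
cliques zero    _        = 1
cliques (suc k) []       = 0
cliques (suc k) (a ∷ as) = a * cliques k as + cliques (suc k) as

-- binom n k d  =  (n choose k)_d  = number of k-cliques of T_d(n), n ≥ 0.
-- (For k > n this is 0 automatically.)
binom : ℕ → ℕ → ℕ → ℕ
binom n k d = cliques k (turanParts d n)

binomℤ : ℤ → ℕ → ℕ → ℕ
binomℤ (+ n)    k d = binom n k d
binomℤ -[1+ _ ] k d = 0

-- Safe floor division (divisor 0 never occurs in the statement).
div : ℕ → ℕ → ℕ
div x zero    = 0
div x (suc d) = x / suc d

-- A representation is the list [N_k, N_{k-1}, ..., N_{k-s}] (length s+1).
-- value k r xs = Σ_{i} binom (N_{k-i}) (k-i) (r-i)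
value : ℕ → ℕ → List ℕ → ℕ
value k r []       = 0
value k r (x ∷ xs) = binom x k r + value (k ∸ 1) (r ∸ 1) xs

Canon : ℕ → ℕ → List ℕ → Set
Canon k r []           = Data.Empty.⊥ where import Data.Empty
Canon k r (x ∷ [])     = (k ≤ x) × (0 < k)
Canon k r (x ∷ y ∷ ys) = (y < x ∸ div x r) × Canon (k ∸ 1) (r ∸ 1) (y ∷ ys)

IsCanonRep : ℕ → ℕ → ℕ → List ℕ → Set
IsCanonRep k r N xs = Canon k r xs × value k r xs ≡ N

plusList : ℕ → List ℕ → List ℕ
plusList r []       = []
plusList r (x ∷ xs) = (x + r) ∷ plusList (r ∸ 1) xs

plusVal : ℕ → ℕ → List ℕ → ℕ
plusVal k r xs = value k r (plusList r xs)

minusList : ℕ → List ℕ → List ℤ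
minusList r []       = []
minusList r (x ∷ xs) = (+ x ℤ.- + r) ∷ minusList (r ∸ 1) xs

valueℤ : ℕ → ℕ → List ℤ → ℕ
valueℤ k r []       = 0
valueℤ k r (z ∷ zs) = binomℤ z k r + valueℤ (k ∸ 1) (r ∸ 1) zs

minusVal : ℕ → ℕ → List ℕ → ℕ
minusVal k r xs = valueℤ k r (minusList r xs)

-- i-th entry of a list (0 outside the range; only used in range).
nth : List ℕ → ℕ → ℕ
nth []       _       = 0
nth (x ∷ xs) zero    = x
nth (x ∷ xs) (suc i) = nth xs i

Good : ℕ → ℕ → List ℕ → ℕ → Set
Good k r xs t = (t < length xs) × (+ (k ∸ t) ℤ.≤ + nth xs t ℤ.- + (r ∸ t))

module Submission where

-- Pascal's rule (n+1 choose k+1)_{d+1} = (n choose k+1)_{d+1} + (n − ⌊n/(d+1)⌋ choose k)_d,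
-- unfolded along a canonical representation, bounds every tail sum by the
-- binomial of its first entry plus one (iv), so the value of a canonical
-- representation is strictly monotone in the lexicographic order, proper prefixes
-- being smaller (iii).  Since (x+r) − ⌊(x+r)/r⌋ = (x − ⌊x/r⌋) + (r−1), shifting the
-- i-th entry up by r−i keeps the chain conditions (i), and so does shifting down as
-- long as the entries stay ≥ k−i; after the first one that drops below, all later
-- ones do too and their terms vanish (ii).  Both shifts are mutually inverse on
-- lexicographic comparisons, which with (iii) gives (v).

open import Defs
open import Data.Nat using (ℕ; zero; suc; _+_; _*_; _∸_; _≤_; _<_; _≤′_; ≤′-refl; ≤′-step; z≤n; s≤s; s≤s⁻¹; _≤?_; NonZero)
open import Data.Nat.Properties
open import Data.Nat.DivMod
open import Data.Nat.Divisibility using (divides-refl)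
open import Data.Nat.Solver using (module +-*-Solver)
open import Data.Integer as ℤ using (+_; -[1+_])
import Data.Integer.Properties as ℤP
open import Data.List using (List; []; _∷_; _++_; map; length; take; replicate)
open import Data.List.Properties using (++-identityʳ)
open import Data.List.Relation.Binary.Pointwise using (Pointwise-≡⇒≡; ≡⇒Pointwise-≡)
open import Data.List.Relation.Binary.Lex.Strict using (Lex-<; base; halt; this; next; xs≮[]; <-compare)
open import Data.Product using (_×_; _,_; ∃-syntax)
open import Data.Sum using (_⊎_; inj₁; inj₂)
open import Data.Unit using (⊤; tt)
open import Function using (_∘_)
open import Function.Bundles using (_⇔_; mk⇔)
open import Function.Properties.Equivalence using (⇔-setoid) renaming (trans to ⇔-trans)
open import Function.Related.TypeIsomorphisms using (¬-cong-⇔)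
open import Relation.Binary.Definitions using (Trichotomous; tri<; tri≈; tri>)
open import Relation.Binary.PropositionalEquality
import Relation.Binary.Reasoning.Setoid as SetoidReasoning
open import Level using (0ℓ)
open import Relation.Nullary using (¬_; yes; no; contradiction)

-- Pascal's rule for Turán clique numbers

cliques-++-suc : ∀ k P x S →
  cliques (suc k) (P ++ suc x ∷ S) ≡ cliques (suc k) (P ++ x ∷ S) + cliques k (P ++ S)
cliques-++-suc k [] x S =
  solve 3 (λ a b y → a :+ y :* a :+ b := (y :* a :+ b) :+ a) refl (cliques k S) (cliques (suc k) S) x
  where open +-*-Solver
cliques-++-suc zero (p ∷ P) x S rewrite cliques-++-suc zero P x S =
  sym (+-assoc (p * 1) (cliques 1 (P ++ x ∷ S)) 1)
cliques-++-suc (suc k) (p ∷ P) x S rewrite cliques-++-suc k P x S | cliques-++-suc (suc k) P x S =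
  solve 5 (λ q a b c d → q :* (a :+ b) :+ (c :+ d) := q :* a :+ c :+ (q :* b :+ d)) refl
    p (cliques (suc k) (P ++ x ∷ S)) (cliques k (P ++ S))
      (cliques (suc (suc k)) (P ++ x ∷ S)) (cliques (suc k) (P ++ S))
  where open +-*-Solver

replicate-suc-++ : ∀ {A : Set} m (x : A) ys → replicate (suc m) x ++ ys ≡ replicate m x ++ x ∷ ys
replicate-suc-++ zero    x ys = refl
replicate-suc-++ (suc m) x ys = cong (x ∷_) (replicate-suc-++ m x ys)

[m+qn]/n≡q : ∀ {m n} q .{{_ : NonZero n}} → m < n → (m + q * n) / n ≡ q
[m+qn]/n≡q {m} {n} q m<n = begin
  (m + q * n) / n     ≡⟨ +-distrib-/-∣ʳ m (divides-refl q) ⟩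
  m / n + q * n / n   ≡⟨ cong₂ _+_ (m<n⇒m/n≡0 m<n) (m*n/n≡m q n) ⟩
  q                   ∎
  where open ≡-Reasoning

[m+qn]%n≡m : ∀ {m n} q .{{_ : NonZero n}} → m < n → (m + q * n) % n ≡ m
[m+qn]%n≡m {m} {n} q m<n = trans ([m+kn]%n≡m%n m q n) (m<n⇒m%n≡m m<n)

turanParts-+*-< : ∀ {m d} q → m < suc d →
  turanParts (suc d) (m + q * suc d) ≡ replicate m (suc q) ++ replicate (suc d ∸ m) q
turanParts-+*-< q m<d rewrite [m+qn]/n≡q q m<d | [m+qn]%n≡m q m<d = refl

turanParts-+* : ∀ {m d} q → m ≤ d →
  turanParts d (m + q * d) ≡ replicate m (suc q) ++ replicate (d ∸ m) q
turanParts-+* {d = zero} q z≤n = refl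
turanParts-+* {m} {suc d} q m≤d with m≤n⇒m<n∨m≡n m≤d
... | inj₁ m<d  = turanParts-+*-< q m<d
... | inj₂ refl = trans (turanParts-+*-< (suc q) (s≤s z≤n))
  (sym (trans (cong (λ j → replicate m (suc q) ++ replicate j q) (n∸n≡0 d)) (++-identityʳ _)))

n∸n/[1+d]≡n%[1+d]+n/[1+d]*d : ∀ n d → n ∸ n / suc d ≡ n % suc d + n / suc d * d
n∸n/[1+d]≡n%[1+d]+n/[1+d]*d n d = begin
  n ∸ q                   ≡⟨ cong (_∸ q) (m≡m%n+[m/n]*n n (suc d)) ⟩
  (m + q * suc d) ∸ q     ≡⟨ cong (λ z → (m + z) ∸ q) (*-suc q d) ⟩
  (m + (q + q * d)) ∸ q   ≡⟨ cong (_∸ q) (+-comm m (q + q * d)) ⟩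
  (q + q * d + m) ∸ q     ≡⟨ cong (_∸ q) (+-assoc q (q * d) m) ⟩
  (q + (q * d + m)) ∸ q   ≡⟨ m+n∸m≡n q (q * d + m) ⟩
  q * d + m               ≡⟨ +-comm (q * d) m ⟩
  m + q * d               ∎
  where
  open ≡-Reasoning
  m = n % suc d
  q = n / suc d

-- The new vertex of T_{d+1}(n+1) joins a smallest part of T_{d+1}(n); deleting that
-- part leaves T_d(n − ⌊n/(d+1)⌋), which hosts the rest of any clique through it.
binom-pascal : ∀ n k d →
  binom (suc n) (suc k) (suc d) ≡ binom n (suc k) (suc d) + binom (n ∸ n / suc d) k d
binom-pascal n k d = begin
  cliques (suc k) (turanParts (suc d) (suc n))      ≡⟨ cong (cliques (suc k)) partsAfter ⟩
  cliques (suc k) (P ++ suc q ∷ S)                  ≡⟨ cliques-++-suc k P q S ⟩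
  cliques (suc k) (P ++ q ∷ S) + cliques k (P ++ S)
    ≡⟨ cong₂ _+_ (cong (cliques (suc k)) (sym partsBefore)) (cong (cliques k) (sym partsRest)) ⟩
  binom n (suc k) (suc d) + binom (n ∸ q) k d       ∎
  where
  open ≡-Reasoning
  m = n % suc d
  q = n / suc d
  P = replicate m (suc q)
  S = replicate (d ∸ m) q
  m≤d : m ≤ d
  m≤d = s≤s⁻¹ (m%n<n n (suc d))
  n≡m+q[1+d] : n ≡ m + q * suc d
  n≡m+q[1+d] = m≡m%n+[m/n]*n n (suc d)
  partsAfter : turanParts (suc d) (suc n) ≡ P ++ suc q ∷ S
  partsAfter = trans (cong (turanParts (suc d) ∘ suc) n≡m+q[1+d])
    (trans (turanParts-+* q (s≤s m≤d)) (replicate-suc-++ m (suc q) S))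
  partsBefore : turanParts (suc d) n ≡ P ++ q ∷ S
  partsBefore = trans (cong (turanParts (suc d)) n≡m+q[1+d])
    (trans (turanParts-+* q (m≤n⇒m≤1+n m≤d)) (cong (λ j → P ++ replicate j q) (+-∸-assoc 1 m≤d)))
  partsRest : turanParts d (n ∸ q) ≡ P ++ S
  partsRest = trans (cong (turanParts d) (n∸n/[1+d]≡n%[1+d]+n/[1+d]*d n d)) (turanParts-+* q m≤d)

binom-≤-suc : ∀ n k d → binom n k d ≤ binom (suc n) k d
binom-≤-suc n zero    d       = ≤-refl
binom-≤-suc n (suc k) zero    = ≤-refl
binom-≤-suc n (suc k) (suc d) rewrite binom-pascal n k d = m≤m+n _ _

binom-monoˡ-≤ : ∀ k d {m n} → m ≤ n → binom m k d ≤ binom n k d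
binom-monoˡ-≤ k d = go ∘ ≤⇒≤′
  where
  go : ∀ {m n} → m ≤′ n → binom m k d ≤ binom n k d
  go ≤′-refl       = ≤-refl
  go (≤′-step m≤n) = ≤-trans (go m≤n) (binom-≤-suc _ k d)

k≤n∸n/[1+d] : ∀ {k n} d → k ≤ n → k ≤ d → k ≤ n ∸ n / suc d
k≤n∸n/[1+d] {k} {n} d k≤n k≤d with n / suc d | m/n*n≤m n (suc d)
... | zero  | _               = k≤n
... | suc q | [1+q][1+d]≤n    = m+n≤o⇒m≤o∸n k (begin
  k + suc q               ≤⟨ +-monoˡ-≤ (suc q) k≤d ⟩
  d + suc q               ≡⟨ +-suc d q ⟩
  suc (d + q)             ≤⟨ s≤s (+-monoʳ-≤ d (m≤m*n q (suc d))) ⟩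
  suc (d + q * suc d)     ≤⟨ [1+q][1+d]≤n ⟩
  n                       ∎)
  where open ≤-Reasoning

binom-pos : ∀ {n k d} → k ≤ n → k ≤ d → 0 < binom n k d
binom-pos {k = zero} _ _ = s≤s z≤n
binom-pos {suc n} {suc k} {suc d} (s≤s k≤n) (s≤s k≤d) rewrite binom-pascal n k d =
  <-≤-trans (binom-pos (k≤n∸n/[1+d] d k≤n k≤d) k≤d) (m≤n+m _ _)

cliques-replicate-0 : ∀ k j → cliques (suc k) (replicate j 0) ≡ 0
cliques-replicate-0 k zero    = refl
cliques-replicate-0 k (suc j) = cliques-replicate-0 k j

binom-< : ∀ {n k} d → n < k → binom n k d ≡ 0
binom-< {zero}  {suc k} zero    _ = refl
binom-< {zero}  {suc k} (suc d) _ = cliques-replicate-0 k (suc d)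
binom-< {suc n} {suc k} zero    _ = refl
binom-< {suc n} {suc k} (suc d) (s≤s n<k) = begin
  binom (suc n) (suc k) (suc d)                             ≡⟨ binom-pascal n k d ⟩
  binom n (suc k) (suc d) + binom (n ∸ n / suc d) k d
    ≡⟨ cong₂ _+_ (binom-< (suc d) (m≤n⇒m≤1+n n<k)) (binom-< d (≤-<-trans (m∸n≤m n (n / suc d)) n<k)) ⟩
  0                                                         ∎
  where open ≡-Reasoning

-- Canonical representations and the lexicographic order

Canon₀ : ℕ → ℕ → List ℕ → Set
Canon₀ k r []       = ⊤
Canon₀ k r (x ∷ xs) = Canon k r (x ∷ xs)

canon-tail : ∀ {k r x} xs → Canon k r (x ∷ xs) → Canon₀ (k ∸ 1) (r ∸ 1) xs
canon-tail []      _       = tt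
canon-tail (_ ∷ _) (_ , c) = c

canon-pos : ∀ {k r} xs → Canon k r xs → 0 < k
canon-pos (_ ∷ [])          (_ , 0<k) = 0<k
canon-pos {zero}  (_ ∷ y ∷ ys) (_ , c) with () ← canon-pos (y ∷ ys) c
canon-pos {suc k} (_ ∷ _ ∷ _)  _       = s≤s z≤n

canon-head : ∀ {k r x} xs → Canon k r (x ∷ xs) → k ≤ x
canon-head []       (k≤x , _) = k≤x
canon-head {k} {r} {x} (y ∷ ys) (y<x∸x/r , c) = begin
  k                  ≤⟨ m≤n+m∸n k 1 ⟩
  suc (k ∸ 1)        ≤⟨ s≤s (canon-head ys c) ⟩
  suc y              ≤⟨ y<x∸x/r ⟩
  x ∸ div x r        ≤⟨ m∸n≤m x (div x r) ⟩
  x                  ∎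
  where open ≤-Reasoning

canon-drop : ∀ {k r} p {a u} → Canon₀ k r (p ++ a ∷ u) →
  Canon (k ∸ length p) (r ∸ length p) (a ∷ u)
canon-drop []      c = c
canon-drop {k} {r} (x ∷ p) {a} {u} c =
  subst₂ (λ k′ r′ → Canon k′ r′ (a ∷ u)) (∸-+-assoc k 1 (length p)) (∸-+-assoc r 1 (length p))
    (canon-drop p (canon-tail (p ++ a ∷ u) c))

-- Pascal's rule at the head leaves the same bound for the tail; at the last entry
-- k ≤ r makes the binomial positive.
value<binom-suc-head : ∀ {k r a} u → k ≤ r → Canon k r (a ∷ u) → value k r (a ∷ u) < binom (suc a) k r
value<binom-suc-head {zero} u _ c with () ← canon-pos (_ ∷ u) c
value<binom-suc-head {suc k} {zero} _ () _
value<binom-suc-head {suc k} {suc r} {a} u (s≤s k≤r) c rewrite binom-pascal a k r =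
  +-monoʳ-< (binom a (suc k) (suc r)) (tail< u c)
  where
  tail< : ∀ u → Canon (suc k) (suc r) (a ∷ u) → value k r u < binom (a ∸ a / suc r) k r
  tail< []      (k<a , _) = binom-pos (k≤n∸n/[1+d] r (<⇒≤ k<a) k≤r) k≤r
  tail< (b ∷ u) (b<a∸a/r , c) = <-≤-trans (value<binom-suc-head u k≤r c) (binom-monoˡ-≤ k r b<a∸a/r)

infix 4 _<ₗₑₓ_
_<ₗₑₓ_ : List ℕ → List ℕ → Set
_<ₗₑₓ_ = Lex-< _≡_ _<_

<ₗₑₓ-compare : Trichotomous _≡_ _<ₗₑₓ_
<ₗₑₓ-compare xs ys with <-compare sym <-cmp xs ys
... | tri< a ¬b ¬c = tri< a (¬b ∘ ≡⇒Pointwise-≡) ¬c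
... | tri≈ ¬a b ¬c = tri≈ ¬a (Pointwise-≡⇒≡ b) ¬c
... | tri> ¬a ¬b c = tri> ¬a (¬b ∘ ≡⇒Pointwise-≡) c

value-mono-<ₗₑₓ : ∀ {k r A B} → k ≤ r → Canon₀ k r A → Canon₀ k r B → A <ₗₑₓ B → value k r A < value k r B
value-mono-<ₗₑₓ k≤r _  cB (halt {ys = ys}) = <-≤-trans (binom-pos (canon-head ys cB) k≤r) (m≤m+n _ _)
value-mono-<ₗₑₓ {k} {r} k≤r cA _ (this {xs = xs} a<b) =
  <-≤-trans (value<binom-suc-head xs k≤r cA) (≤-trans (binom-monoˡ-≤ k r a<b) (m≤m+n _ _))
value-mono-<ₗₑₓ k≤r cA cB (next {xs = xs} {ys = ys} refl xs<ys) =
  +-monoʳ-< _ (value-mono-<ₗₑₓ (∸-monoˡ-≤ 1 k≤r) (canon-tail xs cA) (canon-tail ys cB) xs<ys)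

value-<⇔<ₗₑₓ : ∀ {k r A B} → k ≤ r → Canon₀ k r A → Canon₀ k r B →
  (value k r A < value k r B) ⇔ (A <ₗₑₓ B)
value-<⇔<ₗₑₓ {k} {r} {A} {B} k≤r cA cB = mk⇔ to (value-mono-<ₗₑₓ k≤r cA cB)
  where
  to : value k r A < value k r B → A <ₗₑₓ B
  to v< with <ₗₑₓ-compare A B
  ... | tri< A<B _ _  = A<B
  ... | tri≈ _ refl _ = contradiction v< (<-irrefl refl)
  ... | tri> _ _ B<A  = contradiction (value-mono-<ₗₑₓ k≤r cB cA B<A) (<-asym v<)

value-≤⇔≮ₗₑₓ : ∀ {k r A B} → k ≤ r → Canon₀ k r A → Canon₀ k r B →
  (value k r A ≤ value k r B) ⇔ (¬ B <ₗₑₓ A)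
value-≤⇔≮ₗₑₓ k≤r cA cB =
  ⇔-trans (mk⇔ ≤⇒≯ ≮⇒≥) (¬-cong-⇔ (value-<⇔<ₗₑₓ k≤r cB cA))

ProperPrefix⊎FirstDifference : List ℕ → List ℕ → Set
ProperPrefix⊎FirstDifference A B =
  (∃[ c ] ∃[ rest ] (B ≡ A ++ c ∷ rest))
  ⊎ (∃[ p ] ∃[ a ] ∃[ b ] ∃[ u ] ∃[ v ] ((A ≡ p ++ a ∷ u) × (B ≡ p ++ b ∷ v) × (a < b)))

<ₗₑₓ⇔properPrefix⊎firstDifference : ∀ {A B} → (A <ₗₑₓ B) ⇔ ProperPrefix⊎FirstDifference A B
<ₗₑₓ⇔properPrefix⊎firstDifference = mk⇔ to from
  where
  to : ∀ {A B} → A <ₗₑₓ B → ProperPrefix⊎FirstDifference A B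
  to (halt {y} {ys}) = inj₁ (y , ys , refl)
  to (this {x} {xs} {y} {ys} x<y) = inj₂ ([] , x , y , xs , ys , refl , refl , x<y)
  to (next {x} refl xs<ys) with to xs<ys
  ... | inj₁ (c , rest , refl) = inj₁ (c , rest , refl)
  ... | inj₂ (p , a , b , u , v , refl , refl , a<b) = inj₂ (x ∷ p , a , b , u , v , refl , refl , a<b)
  prefix : ∀ A {c rest} → A <ₗₑₓ A ++ c ∷ rest
  prefix []      = halt
  prefix (x ∷ A) = next refl (prefix A)
  first-difference : ∀ p {a b u v} → a < b → p ++ a ∷ u <ₗₑₓ p ++ b ∷ v
  first-difference []      a<b = this a<b
  first-difference (x ∷ p) a<b = next refl (first-difference p a<b)
  from : ∀ {A B} → ProperPrefix⊎FirstDifference A B → A <ₗₑₓ B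
  from {A} (inj₁ (c , rest , refl)) = prefix A
  from (inj₂ (p , a , b , u , v , refl , refl , a<b)) = first-difference p a<b

-- Shifting the entries up and down

[x+r]∸[x+r]/r≡x∸x/r+[r∸1] : ∀ x r → (x + r) ∸ div (x + r) r ≡ (x ∸ div x r) + (r ∸ 1)
[x+r]∸[x+r]/r≡x∸x/r+[r∸1] x zero    = refl
[x+r]∸[x+r]/r≡x∸x/r+[r∸1] x (suc r) = begin
  (x + suc r) ∸ (x + suc r) / suc r   ≡⟨ cong ((x + suc r) ∸_) [x+1+r]/[1+r]≡1+x/[1+r] ⟩
  (x + suc r) ∸ suc (x / suc r)       ≡⟨ cong (_∸ suc (x / suc r)) (+-suc x r) ⟩
  (x + r) ∸ x / suc r                 ≡⟨ +-∸-comm r (m/n≤m x (suc r)) ⟩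
  (x ∸ x / suc r) + r                 ∎
  where
  open ≡-Reasoning
  [x+1+r]/[1+r]≡1+x/[1+r] : (x + suc r) / suc r ≡ suc (x / suc r)
  [x+1+r]/[1+r]≡1+x/[1+r] = trans (m/n≡1+[m∸n]/n (m≤n+m (suc r) x))
    (cong (λ z → suc (z / suc r)) (m+n∸n≡m x (suc r)))

canon-plusList : ∀ {k} r x xs → Canon k r (x ∷ xs) → Canon k r (plusList r (x ∷ xs))
canon-plusList r x []       (k≤x , 0<k) = ≤-trans k≤x (m≤m+n x r) , 0<k
canon-plusList r x (y ∷ ys) (y<x∸x/r , c) =
  subst (y + (r ∸ 1) <_) (sym ([x+r]∸[x+r]/r≡x∸x/r+[r∸1] x r)) (+-monoˡ-< (r ∸ 1) y<x∸x/r)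
  , canon-plusList (r ∸ 1) y ys c

chain-∸ : ∀ {x y} r → r ≤ x → r ∸ 1 ≤ y → y < x ∸ div x r →
  y ∸ (r ∸ 1) < (x ∸ r) ∸ div (x ∸ r) r
chain-∸ {x} {y} r r≤x r∸1≤y y<x∸x/r =
  subst (y ∸ (r ∸ 1) <_) (m+n∸n≡m (x′ ∸ div x′ r) (r ∸ 1)) (∸-monoˡ-< y<shifted r∸1≤y)
  where
  x′ = x ∸ r
  y<shifted : y < (x′ ∸ div x′ r) + (r ∸ 1)
  y<shifted = subst (y <_) ([x+r]∸[x+r]/r≡x∸x/r+[r∸1] x′ r)
    (subst (λ z → y < z ∸ div z r) (sym (m∸n+n≡m r≤x)) y<x∸x/r)

+m-+n≡+[m∸n] : ∀ {m n} → n ≤ m → + m ℤ.- + n ≡ + (m ∸ n)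
+m-+n≡+[m∸n] {m} {n} n≤m = trans (ℤP.m-n≡m⊖n m n) (ℤP.⊖-≥ n≤m)

+m-+n≡-[1+_] : ∀ {m n} → m < n → ∃[ j ] (+ m ℤ.- + n ≡ -[1+ j ])
+m-+n≡-[1+_] {m} {n} m<n with n ∸ m | m<n⇒0<n∸m m<n | trans (ℤP.m-n≡m⊖n m n) (ℤP.⊖-< m<n)
... | suc j | _ | m-n≡-[1+j] = j , m-n≡-[1+j]

+k≤+x-+r⇒k+r≤x : ∀ {k x r} → + k ℤ.≤ + x ℤ.- + r → k + r ≤ x
+k≤+x-+r⇒k+r≤x {k} {x} {r} k≤x-r with r ≤? x
... | yes r≤x rewrite +m-+n≡+[m∸n] r≤x with k≤x-r
...   | ℤ.+≤+ k≤x∸r = subst (k + r ≤_) (m∸n+n≡m r≤x) (+-monoˡ-≤ r k≤x∸r)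
+k≤+x-+r⇒k+r≤x {k} {x} {r} k≤x-r | no r≰x with +m-+n≡-[1+_] (≰⇒> r≰x)
... | _ , x-r≡-[1+j] with () ← subst (+ k ℤ.≤_) x-r≡-[1+j] k≤x-r

k+r≤x⇒+k≤+x-+r : ∀ {k x r} → k + r ≤ x → + k ℤ.≤ + x ℤ.- + r
k+r≤x⇒+k≤+x-+r {k} k+r≤x rewrite +m-+n≡+[m∸n] (m+n≤o⇒n≤o k k+r≤x) = ℤ.+≤+ (m+n≤o⇒m≤o∸n k k+r≤x)

+x-+r<+k⇒x<k+r : ∀ {k x r} → + x ℤ.- + r ℤ.< + k → x < k + r
+x-+r<+k⇒x<k+r {k} {x} {r} x-r<k with r ≤? x
... | no r≰x = ≤-trans (≰⇒> r≰x) (m≤n+m r k)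
... | yes r≤x rewrite +m-+n≡+[m∸n] r≤x with x-r<k
...   | ℤ.+<+ x∸r<k = subst (_≤ k + r) (cong suc (m∸n+n≡m r≤x)) (+-monoˡ-≤ r x∸r<k)

binomℤ[x-r]≡binom[x∸r] : ∀ {x r} k d → r ≤ x → binomℤ (+ x ℤ.- + r) k d ≡ binom (x ∸ r) k d
binomℤ[x-r]≡binom[x∸r] k d r≤x rewrite +m-+n≡+[m∸n] r≤x = refl

binomℤ[x-r]≡0 : ∀ {x} k r → x < k + r → binomℤ (+ x ℤ.- + r) k r ≡ 0
binomℤ[x-r]≡0 {x} k r x<k+r with r ≤? x
... | yes r≤x = trans (binomℤ[x-r]≡binom[x∸r] k r r≤x)
  (binom-< r (subst (x ∸ r <_) (m+n∸n≡m k r) (∸-monoˡ-< x<k+r r≤x)))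
... | no r≰x with +m-+n≡-[1+_] (≰⇒> r≰x)
...   | _ , x-r≡-[1+j] rewrite x-r≡-[1+j] = refl

short-next : ∀ k r {x y} → x < suc k + suc r → y < x ∸ x / suc r → y < k + r
short-next k r {x} {y} x<k+r y<x∸x/r with suc r ≤? x
... | no r≮x = begin-strict
  y              <⟨ y<x∸x/r ⟩
  x ∸ x / suc r  ≤⟨ m∸n≤m x (x / suc r) ⟩
  x              ≤⟨ s≤s⁻¹ (≰⇒> r≮x) ⟩
  r              ≤⟨ m≤n+m r k ⟩
  k + r          ∎
  where open ≤-Reasoning
... | yes r<x = begin-strict
  y              <⟨ y<x∸x/r ⟩
  x ∸ x / suc r  ≤⟨ ∸-monoʳ-≤ x (m≥n⇒m/n>0 r<x) ⟩
  x ∸ 1          ≤⟨ ∸-monoˡ-≤ 1 (subst (x ≤_) (+-suc k r) (s≤s⁻¹ x<k+r)) ⟩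
  k + r          ∎
  where open ≤-Reasoning

minusVal≡0 : ∀ k r {x} xs → k ≤ r → Canon k r (x ∷ xs) → x < k + r → minusVal k r (x ∷ xs) ≡ 0
minusVal≡0 k r [] _ _ x<k+r = cong (_+ 0) (binomℤ[x-r]≡0 k r x<k+r)
minusVal≡0 zero r (y ∷ ys) _ c _ with () ← canon-pos {0} {r} (_ ∷ y ∷ ys) c
minusVal≡0 (suc k) zero (_ ∷ _) () _ _
minusVal≡0 (suc k) (suc r) (y ∷ ys) (s≤s k≤r) (y<x∸x/r , c) x<k+r =
  cong₂ _+_ (binomℤ[x-r]≡0 (suc k) (suc r) x<k+r) (minusVal≡0 k r ys k≤r c (short-next k r x<k+r y<x∸x/r))

-- The representation of N₋ in (ii): the down-shifted entries up to index s₀.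
minusRep : ℕ → ℕ → List ℕ → List ℕ
minusRep k r []       = []
minusRep k r (x ∷ xs) with k + r ≤? x
... | yes _ = (x ∸ r) ∷ minusRep (k ∸ 1) (r ∸ 1) xs
... | no  _ = []

minusVal≡value-minusRep : ∀ {k r} X → k ≤ r → Canon₀ k r X → minusVal k r X ≡ value k r (minusRep k r X)
minusVal≡value-minusRep [] _ _ = refl
minusVal≡value-minusRep {k} {r} (x ∷ xs) k≤r c with k + r ≤? x
... | yes k+r≤x = cong₂ _+_ (binomℤ[x-r]≡binom[x∸r] k r (m+n≤o⇒n≤o k k+r≤x))
  (minusVal≡value-minusRep xs (∸-monoˡ-≤ 1 k≤r) (canon-tail xs c))
... | no k+r≰x = minusVal≡0 k r xs k≤r c (≰⇒> k+r≰x)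

canon-minusRep : ∀ {k r} X → Canon₀ k r X → Canon₀ k r (minusRep k r X)
canon-minusRep [] _ = tt
canon-minusRep {k} {r} (x ∷ xs) c with k + r ≤? x
... | no _ = tt
canon-minusRep {k} {r} (x ∷ []) c | yes k+r≤x = m+n≤o⇒m≤o∸n k k+r≤x , canon-pos {r = r} (x ∷ []) c
canon-minusRep {k} {r} (x ∷ y ∷ ys) (y<x∸x/r , c) | yes k+r≤x
  with (k ∸ 1) + (r ∸ 1) ≤? y | canon-minusRep (y ∷ ys) c
... | no _ | _ = m+n≤o⇒m≤o∸n k k+r≤x , canon-pos {r = r} (x ∷ y ∷ ys) (y<x∸x/r , c)
... | yes k′+r′≤y | c′ = chain-∸ r (m+n≤o⇒n≤o k k+r≤x) (m+n≤o⇒n≤o (k ∸ 1) k′+r′≤y) y<x∸x/r , c′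

map-+-minusRep≡take : ∀ k r X → map +_ (minusRep k r X) ≡ take (length (minusRep k r X)) (minusList r X)
map-+-minusRep≡take k r [] = refl
map-+-minusRep≡take k r (x ∷ xs) with k + r ≤? x
... | yes k+r≤x = cong₂ _∷_ (sym (+m-+n≡+[m∸n] (m+n≤o⇒n≤o k k+r≤x))) (map-+-minusRep≡take (k ∸ 1) (r ∸ 1) xs)
... | no  _     = refl

good-suc : ∀ k r x xs t → Good (k ∸ 1) (r ∸ 1) xs t → Good k r (x ∷ xs) (suc t)
good-suc k r x xs t (t<len , k≤x-r) =
  s≤s t<len , subst₂ (λ k′ r′ → + k′ ℤ.≤ + nth xs t ℤ.- + r′) (∸-+-assoc k 1 t) (∸-+-assoc r 1 t) k≤x-r

good-suc⁻¹ : ∀ k r x xs t → Good k r (x ∷ xs) (suc t) → Good (k ∸ 1) (r ∸ 1) xs t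
good-suc⁻¹ k r x xs t (t<len , k≤x-r) =
  s≤s⁻¹ t<len , subst₂ (λ k′ r′ → + k′ ℤ.≤ + nth xs t ℤ.- + r′) (sym (∸-+-assoc k 1 t)) (sym (∸-+-assoc r 1 t)) k≤x-r

<length-minusRep⇒Good : ∀ k r X t → t < length (minusRep k r X) → Good k r X t
<length-minusRep⇒Good k r (x ∷ xs) t t<len with k + r ≤? x
<length-minusRep⇒Good k r (x ∷ xs) zero    _            | yes k+r≤x = s≤s z≤n , k+r≤x⇒+k≤+x-+r k+r≤x
<length-minusRep⇒Good k r (x ∷ xs) (suc t) (s≤s t<len) | yes _     =
  good-suc k r x xs t (<length-minusRep⇒Good (k ∸ 1) (r ∸ 1) xs t t<len)

short⇒¬Good : ∀ k r {x} xs t → k ≤ r → Canon k r (x ∷ xs) → x < k + r → ¬ Good k r (x ∷ xs) t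
short⇒¬Good k r xs zero _ _ x<k+r (_ , k≤x-r) = <⇒≱ x<k+r (+k≤+x-+r⇒k+r≤x k≤x-r)
short⇒¬Good k r [] (suc t) _ _ _ (s≤s () , _)
short⇒¬Good zero r (y ∷ ys) (suc t) _ c _ with () ← canon-pos {0} {r} (_ ∷ y ∷ ys) c
short⇒¬Good (suc k) zero (_ ∷ _) (suc t) () _ _
short⇒¬Good (suc k) (suc r) {x} (y ∷ ys) (suc t) (s≤s k≤r) (y<x∸x/r , c) x<k+r g =
  short⇒¬Good k r ys t k≤r c (short-next k r x<k+r y<x∸x/r) (good-suc⁻¹ (suc k) (suc r) x (y ∷ ys) t g)

Good⇒<length-minusRep : ∀ k r X t → k ≤ r → Canon₀ k r X → Good k r X t → t < length (minusRep k r X)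
Good⇒<length-minusRep k r [] t _ _ (() , _)
Good⇒<length-minusRep k r (x ∷ xs) t k≤r c g with k + r ≤? x
Good⇒<length-minusRep k r (x ∷ xs) zero    k≤r c g | yes _ = s≤s z≤n
Good⇒<length-minusRep k r (x ∷ xs) (suc t) k≤r c g | yes _ =
  s≤s (Good⇒<length-minusRep (k ∸ 1) (r ∸ 1) xs t (∸-monoˡ-≤ 1 k≤r) (canon-tail xs c) (good-suc⁻¹ k r x xs t g))
... | no k+r≰x = contradiction g (short⇒¬Good k r xs t k≤r c (≰⇒> k+r≰x))

minusVal-canonRep : ∀ {k r} x xs → k ≤ r → Canon k r (x ∷ xs) →
  (s₀ : ℕ) → Good k r (x ∷ xs) s₀ → ((t : ℕ) → Good k r (x ∷ xs) t → t ≤ s₀) →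
  ∃[ ys ] (IsCanonRep k r (minusVal k r (x ∷ xs)) ys × map +_ ys ≡ take (suc s₀) (minusList r (x ∷ xs)))
minusVal-canonRep {k} {r} x xs k≤r c s₀ good-s₀ s₀-greatest =
  M , (canon₀-nonempty M (canon-minusRep X c) (≤-<-trans z≤n s₀<len) , sym (minusVal≡value-minusRep X k≤r c)) ,
  subst (λ n → map +_ M ≡ take n (minusList r X)) (sym suc-s₀≡len) (map-+-minusRep≡take k r X)
  where
  X = x ∷ xs
  M = minusRep k r X
  canon₀-nonempty : ∀ ys → Canon₀ k r ys → 0 < length ys → Canon k r ys
  canon₀-nonempty (_ ∷ _) c _ = c
  s₀<len : s₀ < length M
  s₀<len = Good⇒<length-minusRep k r X s₀ k≤r c good-s₀
  suc-s₀≡len : suc s₀ ≡ length M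
  suc-s₀≡len with length M | s₀<len | <length-minusRep⇒Good k r X
  ... | suc n | s≤s s₀≤n | good = cong suc (≤-antisym s₀≤n (s₀-greatest n (good n ≤-refl)))

<ₗₑₓ-plusList⇒minusRep-<ₗₑₓ : ∀ k r X ls → X <ₗₑₓ plusList r ls → minusRep k r X <ₗₑₓ ls
<ₗₑₓ-plusList⇒minusRep-<ₗₑₓ k r [] []       (base ())
<ₗₑₓ-plusList⇒minusRep-<ₗₑₓ k r [] (l ∷ ls) halt = halt
<ₗₑₓ-plusList⇒minusRep-<ₗₑₓ k r (x ∷ xs) (l ∷ ls) X<P with k + r ≤? x
... | no  _ = halt
... | yes k+r≤x with X<P
...   | this x<l+r = this (subst (x ∸ r <_) (m+n∸n≡m l r) (∸-monoˡ-< x<l+r (m+n≤o⇒n≤o k k+r≤x)))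
...   | next refl xs<P = next (m+n∸n≡m l r) (<ₗₑₓ-plusList⇒minusRep-<ₗₑₓ (k ∸ 1) (r ∸ 1) xs ls xs<P)

minusRep-<ₗₑₓ⇒<ₗₑₓ-plusList : ∀ k r X ls → Canon₀ k r ls → minusRep k r X <ₗₑₓ ls → X <ₗₑₓ plusList r ls
minusRep-<ₗₑₓ⇒<ₗₑₓ-plusList k r [] (l ∷ ls) _ halt = halt
minusRep-<ₗₑₓ⇒<ₗₑₓ-plusList k r (x ∷ xs) [] _ M<[] = contradiction M<[] xs≮[]
minusRep-<ₗₑₓ⇒<ₗₑₓ-plusList k r (x ∷ xs) (l ∷ ls) c M<L with k + r ≤? x
... | no k+r≰x = this (<-≤-trans (≰⇒> k+r≰x) (+-monoˡ-≤ r (canon-head ls c)))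
... | yes k+r≤x with m∸n+n≡m (m+n≤o⇒n≤o k k+r≤x) | M<L
...   | x∸r+r≡x | this x∸r<l = this (subst (_< l + r) x∸r+r≡x (+-monoˡ-< r x∸r<l))
...   | x∸r+r≡x | next refl M<ls =
  next (sym x∸r+r≡x) (minusRep-<ₗₑₓ⇒<ₗₑₓ-plusList (k ∸ 1) (r ∸ 1) xs ls (canon-tail ls c) M<ls)

plusVal≤⇔≤minusVal : ∀ {k r} x xs l ls → k ≤ r → Canon k r (x ∷ xs) → Canon k r (l ∷ ls) →
  (plusVal k r (l ∷ ls) ≤ value k r (x ∷ xs)) ⇔ (value k r (l ∷ ls) ≤ minusVal k r (x ∷ xs))
plusVal≤⇔≤minusVal {k} {r} x xs l ls k≤r cX cL = begin
  (value k r P ≤ value k r X)     ≈⟨ value-≤⇔≮ₗₑₓ k≤r (canon-plusList r l ls cL) cX ⟩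
  (¬ X <ₗₑₓ P)                    ≈⟨ ¬-cong-⇔ X<P⇔M<L ⟩
  (¬ M <ₗₑₓ L)                    ≈⟨ value-≤⇔≮ₗₑₓ k≤r cL (canon-minusRep X cX) ⟨
  (value k r L ≤ value k r M)     ≡⟨ cong (value k r L ≤_) (sym (minusVal≡value-minusRep X k≤r cX)) ⟩
  (value k r L ≤ minusVal k r X)  ∎
  where
  open SetoidReasoning (⇔-setoid 0ℓ)
  X = x ∷ xs
  L = l ∷ ls
  P = plusList r L
  M = minusRep k r X
  X<P⇔M<L : (X <ₗₑₓ P) ⇔ (M <ₗₑₓ L)
  X<P⇔M<L = mk⇔ (<ₗₑₓ-plusList⇒minusRep-<ₗₑₓ k r X L) (minusRep-<ₗₑₓ⇒<ₗₑₓ-plusList k r X L cL)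

lemma2p5 : (N k r : ℕ) → 0 < N → 0 < k → k ≤ r →
  (x : ℕ) (xs : List ℕ) → IsCanonRep k r N (x ∷ xs) →
  -- (i)
  IsCanonRep k r (plusVal k r (x ∷ xs)) (plusList r (x ∷ xs))
  -- (ii)
  × ((+ k ℤ.≤ + x ℤ.- + r) →
      (s₀ : ℕ) → Good k r (x ∷ xs) s₀ →
      ((t : ℕ) → Good k r (x ∷ xs) t → t ≤ s₀) →
      ∃[ ys ] (IsCanonRep k r (minusVal k r (x ∷ xs)) ys
               × map +_ ys ≡ take (suc s₀) (minusList r (x ∷ xs))))
  × ((+ x ℤ.- + r ℤ.< + k) → minusVal k r (x ∷ xs) ≡ 0)
  -- (iii), (iv), (v)
  × ((L : ℕ) → 0 < L → (ls : List ℕ) → IsCanonRep k r L ls →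
      -- (iii)
      ((L < N) ⇔
        ((∃[ c ] ∃[ rest ] (x ∷ xs ≡ ls ++ c ∷ rest))
         ⊎ (∃[ p ] ∃[ a ] ∃[ b ] ∃[ u ] ∃[ v ]
              ((ls ≡ p ++ a ∷ u) × (x ∷ xs ≡ p ++ b ∷ v) × (a < b)))))
      -- (iv)
      × ((p : List ℕ) (a : ℕ) (u : List ℕ) → ls ≡ p ++ a ∷ u →
          value (k ∸ length p) (r ∸ length p) (a ∷ u)
            < binom (suc a) (k ∸ length p) (r ∸ length p))
      -- (v)
      × ((plusVal k r ls ≤ N) ⇔ (L ≤ minusVal k r (x ∷ xs))))
lemma2p5 N k r _ _ k≤r x xs (cX , refl) =
  (canon-plusList r x xs cX , refl) ,
  (λ _ → minusVal-canonRep x xs k≤r cX) ,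
  (λ x-r<k → minusVal≡0 k r xs k≤r cX (+x-+r<+k⇒x<k+r x-r<k)) ,
  λ { L _ [] (() , _)
    ; L _ (l ∷ ls) (cL , refl) →
        ⇔-trans (value-<⇔<ₗₑₓ k≤r cL cX) <ₗₑₓ⇔properPrefix⊎firstDifference ,
        (λ p a u ls≡p++a∷u → value<binom-suc-head u (∸-monoˡ-≤ (length p) k≤r)
                                (canon-drop p (subst (Canon₀ k r) ls≡p++a∷u cL))) ,
        plusVal≤⇔≤minusVal x xs l ls k≤r cX cL }
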